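{- For any two connected graphs $G$ and $H$, $md(G \square H) = md(G) + md(H)$.
   Context: The Cartesian product $G \square H$ has vertex set $V(G)\times V(H)$, with $(u,v)$ and $(u',v')$ adjacent if and only if either $uu' \in E(G)$ and $v=v'$, or $vv' \in E(H)$ and $u=u'$. An edge-coloring of a graph $G$ is a map $\Gamma: E(G) \to [k]$ (adjacent edges may receive the same color); $|\Gamma|$ is the number of colors used. An edge-cut is monochromatic if all of its edges have the same color. An edge-coloring of $G$ is a monochromatic disconnection coloring (MD-coloring) if any two distinct vertices $u,v$ of $G$ are separated by a monochromatic edge-cut (equivalently, for some color $i$, $u$ and $v$ lie in different components of the graph obtained from $G$ by deleting all edges of color $i$). For a connected graph $G$, $md(G)$ is the maximum number of colors in an MD-coloring of $G$. -}

module Defs where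

open import Data.Nat using (ℕ; _≤_; _+_)
open import Data.Fin using (Fin)
open import Data.Product using (Σ; ∃; _×_; _,_; proj₁; proj₂)
open import Data.Sum using (_⊎_; inj₁; inj₂)
open import Data.Empty using (⊥)
open import Relation.Nullary using (¬_)
open import Relation.Binary.PropositionalEquality using (_≡_; _≢_; refl; sym)
open import Function.Bundles using (_↔_)

record Graph : Set₁ where
  field
    V      : Set
    Adj    : V → V → Set
    adjSym : ∀ {u v} → Adj u v → Adj v u
    irrefl : ∀ {u} → ¬ Adj u u
open Graph public

Finite : Set → Set
Finite A = Σ ℕ λ n → A ↔ Fin n

data Reach {A : Set} (E : A → A → Set) : A → A → Set where
  here : ∀ {u} → Reach E u u
  step : ∀ {u w v} → E u w → Reach E w v → Reach E u v

Connected : Graph → Set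
Connected G = V G × (∀ u v → Reach (Adj G) u v)

_□_ : Graph → Graph → Graph
G □ H = record
  { V      = V G × V H
  ; Adj    = λ { (u , v) (u' , v') → (Adj G u u' × v ≡ v') ⊎ (Adj H v v' × u ≡ u') }
  ; adjSym = λ { (inj₁ (e , p)) → inj₁ (adjSym G e , sym p)
               ; (inj₂ (e , p)) → inj₂ (adjSym H e , sym p) }
  ; irrefl = λ { (inj₁ (e , _)) → irrefl G e ; (inj₂ (e , _)) → irrefl H e }
  }

-- An edge-coloring with colors in Fin k: a color for each edge, independent of the
-- orientation / adjacency proof used to name the edge.
record EdgeColoring (G : Graph) (k : ℕ) : Set where
  field
    col        : ∀ u v → Adj G u v → Fin k
    col-edge   : ∀ u v (e : Adj G u v) (e' : Adj G v u) → col u v e ≡ col v u e'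
open EdgeColoring public

-- The coloring uses all k colors (so |Γ| = k).
UsesAll : ∀ {G k} → EdgeColoring G k → Set
UsesAll {G} {k} Γ = ∀ (i : Fin k) → Σ (V G) λ u → Σ (V G) λ v → Σ (Adj G u v) λ e → col Γ u v e ≡ i

DeleteColor : ∀ {G k} → EdgeColoring G k → Fin k → V G → V G → Set
DeleteColor {G} Γ i u v = Σ (Adj G u v) λ e → col Γ u v e ≢ i

IsMDColoring : ∀ {G k} → EdgeColoring G k → Set
IsMDColoring {G} {k} Γ =
  ∀ (u v : V G) → u ≢ v → Σ (Fin k) λ i → ¬ Reach (DeleteColor Γ i) u v

HasMD : Graph → ℕ → Set
HasMD G k = Σ (EdgeColoring G k) λ Γ → UsesAll Γ × IsMDColoring Γ

IsMd : Graph → ℕ → Set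
IsMd G m = HasMD G m × (∀ k → HasMD G k → k ≤ m)

-- Lower bound: colour the G-edges of G □ H by an MD-colouring of G and the H-edges
-- by a disjoint copy of one of H; distinct vertices differ in some coordinate, and
-- a walk avoiding a colour class projects to that coordinate.
--
-- Upper bound: in any MD-colouring, opposite edges of a 4-cycle with distinct
-- diagonal ends share a colour (opposite-edges).  On the squares of G □ H this makes
-- all copies of G (rows) carry the same MD-colouring of G, and likewise all copies
-- of H (columns, i.e. rows of the transposed product).  Renumbering the colours a
-- row actually uses (Trim) gives at most md(G) colours, a column at most md(H), and
-- every colour occurs in one of them (cover-bound).  Which colours occur is not
-- decidable constructively, but k ≤ md(G) + md(H) is, so a double negation suffices.
module Submission where

open import Defs
open import Data.Nat using (ℕ; zero; suc; _+_; _≤_; z≤n; s≤s; _≤?_)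
open import Data.Nat.Properties using (≤-trans; +-mono-≤; +-monoʳ-≤; n≤1+n; +-suc)
open import Data.Fin using (Fin; zero; suc; _↑ˡ_; _↑ʳ_; splitAt; _≟_)
open import Data.Fin.Properties using (splitAt⁻¹-↑ˡ; splitAt⁻¹-↑ʳ)
open import Data.Product using (Σ; _,_; proj₁; proj₂) renaming (swap to swap×)
open import Data.Sum using (_⊎_; inj₁; inj₂; [_,_]) renaming (map to map⊎)
open import Data.Empty using (⊥-elim)
open import Function using (_∘_; id)
open import Function.Properties.Inverse using (↔⇒↣)
open import Relation.Nullary using (¬_; Dec; yes; no)
open import Relation.Nullary.Decidable using (decidable-stable; ¬¬-excluded-middle; via-injection)
open import Relation.Binary.Definitions using (DecidableEquality)
open import Relation.Binary.PropositionalEquality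
  using (_≡_; _≢_; refl; sym; trans; cong; subst)

finite⇒decidableEq : ∀ {A : Set} → Finite A → DecidableEquality A
finite⇒decidableEq (_ , A↔Fin) = via-injection (↔⇒↣ A↔Fin) _≟_

adjacent-distinct : ∀ (G : Graph) {x y} → Adj G x y → x ≢ y
adjacent-distinct G e refl = irrefl G e

module _ {A : Set} {E : A → A → Set} where

  snoc : ∀ {x y z} → Reach E x y → E y z → Reach E x z
  snoc here e = step e here
  snoc (step e r) e' = step e (snoc r e')

  reverse : (∀ {x y} → E x y → E y x) → ∀ {x y} → Reach E x y → Reach E y x
  reverse E-sym here = here
  reverse E-sym (step e r) = snoc (reverse E-sym r) (E-sym e)

Separates : ∀ {G k} → EdgeColoring G k → Fin k → V G → V G → Set
Separates Γ i x y = ¬ Reach (DeleteColor Γ i) x y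

module Separation {G : Graph} {k : ℕ} (Γ : EdgeColoring G k) where

  colour : ∀ {x y} → Adj G x y → Fin k
  colour {x} {y} = col Γ x y

  separates-sym : ∀ {i x y} → Separates Γ i x y → Separates Γ i y x
  separates-sym sep = sep ∘ reverse delete-sym
    where
      delete-sym : ∀ {i x y} → DeleteColor Γ i x y → DeleteColor Γ i y x
      delete-sym {x = x} {y} (e , ≢i) = adjSym G e , ≢i ∘ trans (col-edge Γ x y e (adjSym G e))

  shift : ∀ {i x y z} → Separates Γ i x z → (e : Adj G x y) → colour e ≢ i → Separates Γ i y z
  shift sep e ≢i r = sep (step (e , ≢i) r)

  on-edge : ∀ {i x y} → Separates Γ i x y → (e : Adj G x y) → colour e ≡ i
  on-edge {i} sep e with colour e ≟ i
  ... | yes ≡i = ≡i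
  ... | no ≢i = ⊥-elim (shift sep e ≢i here)

  on-2path : ∀ {i x y z} → Separates Γ i x z → (e₁ : Adj G x y) (e₂ : Adj G y z) →
             colour e₁ ≡ i ⊎ colour e₂ ≡ i
  on-2path {i} sep e₁ e₂ with colour e₁ ≟ i
  ... | yes ≡i = inj₁ ≡i
  ... | no ≢i = inj₂ (on-edge (shift sep e₁ ≢i) e₂)

  on-3path : ∀ {i x y z w} → Separates Γ i x w →
             (e₁ : Adj G x y) (e₂ : Adj G y z) (e₃ : Adj G z w) →
             colour e₁ ≡ i ⊎ colour e₂ ≡ i ⊎ colour e₃ ≡ i
  on-3path {i} sep e₁ e₂ e₃ with colour e₁ ≟ i
  ... | yes ≡i = inj₁ ≡i
  ... | no ≢i = inj₂ (on-2path (shift sep e₁ ≢i) e₂ e₃)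

  on-mono-2path : ∀ {i x y z} → Separates Γ i x z → (e₁ : Adj G x y) (e₂ : Adj G y z) →
                  colour e₁ ≡ colour e₂ → colour e₁ ≡ i
  on-mono-2path sep e₁ e₂ same = [ id , trans same ] (on-2path sep e₁ e₂)

  module Squares (md : IsMDColoring Γ) {x₀ x₁ x₂ x₃ : V G} where

    -- The colour separating x₀ from x₁ is that of a, and must reappear on b, c or d.
    around : (a : Adj G x₀ x₁) (b : Adj G x₁ x₂) (c : Adj G x₂ x₃) (d : Adj G x₃ x₀) →
             colour b ≡ colour a ⊎ colour c ≡ colour a ⊎ colour d ≡ colour a
    around a b c d = map⊎ to-a (map⊎ to-a to-a) (on-3path (separates-sym sep) b c d)
      where
        sep = proj₂ (md x₀ x₁ (adjacent-distinct G a))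
        to-a : ∀ {j} → j ≡ proj₁ (md x₀ x₁ (adjacent-distinct G a)) → j ≡ colour a
        to-a j≡i = trans j≡i (sym (on-edge sep a))

    -- If both halves x₀x₁x₂ and x₂x₃x₀ are monochromatic, they share the colour
    -- separating x₀ from x₂.
    diagonal : x₀ ≢ x₂ →
               (a : Adj G x₀ x₁) (b : Adj G x₁ x₂) (c : Adj G x₂ x₃) (d : Adj G x₃ x₀) →
               colour a ≡ colour b → colour c ≡ colour d → colour a ≡ colour c
    diagonal x₀≢x₂ a b c d a≡b c≡d =
      trans (on-mono-2path sep a b a≡b) (sym (on-mono-2path (separates-sym sep) c d c≡d))
      where sep = proj₂ (md x₀ x₂ x₀≢x₂)

  opposite-edges : IsMDColoring Γ → ∀ {x₀ x₁ x₂ x₃} → x₀ ≢ x₂ → x₁ ≢ x₃ →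
                   (a : Adj G x₀ x₁) (b : Adj G x₁ x₂) (c : Adj G x₂ x₃) (d : Adj G x₃ x₀) →
                   colour a ≡ colour c
  opposite-edges md x₀≢x₂ x₁≢x₃ a b c d = combine (around a b c d) (around c d a b)
    where
      open Squares md
      combine : colour b ≡ colour a ⊎ colour c ≡ colour a ⊎ colour d ≡ colour a →
                colour d ≡ colour c ⊎ colour a ≡ colour c ⊎ colour b ≡ colour c →
                colour a ≡ colour c
      combine (inj₂ (inj₁ c≡a)) _ = sym c≡a
      combine _ (inj₂ (inj₁ a≡c)) = a≡c
      combine (inj₁ b≡a) (inj₂ (inj₂ b≡c)) = trans (sym b≡a) b≡c
      combine (inj₂ (inj₂ d≡a)) (inj₁ d≡c) = trans (sym d≡a) d≡c
      combine (inj₁ b≡a) (inj₁ d≡c) = diagonal x₀≢x₂ a b c d (sym b≡a) (sym d≡c)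
      combine (inj₂ (inj₂ d≡a)) (inj₂ (inj₂ b≡c)) =
        trans (sym d≡a) (trans (sym (diagonal x₁≢x₃ b c d a b≡c d≡a)) b≡c)

open Separation using (opposite-edges)

Used : ∀ {G k} → EdgeColoring G k → Fin k → Set
Used {G} Γ i = Σ (V G) λ u → Σ (V G) λ v → Σ (Adj G u v) λ e → col Γ u v e ≡ i

record Enumeration {k : ℕ} (P : Fin k → Set) : Set where
  field
    size             : ℕ
    index            : ∀ i → P i → Fin size
    element          : Fin size → Fin k
    element∈         : ∀ j → P (element j)
    index-element    : ∀ j p → index (element j) p ≡ j
    index-irrelevant : ∀ i p p' → index i p ≡ index i p'

  index-resp : ∀ {i i'} p p' → i ≡ i' → index i p ≡ index i' p'
  index-resp p p' refl = index-irrelevant _ p p'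

enumerate : ∀ {k} (P : Fin k → Set) → (∀ i → Dec (P i)) → Enumeration P
enumerate {zero} P P? = record
  { size = 0 ; index = λ () ; element = λ () ; element∈ = λ ()
  ; index-element = λ () ; index-irrelevant = λ () }
enumerate {suc k} P P? = extend (P? zero) (enumerate (P ∘ suc) (P? ∘ suc))
  where
    extend : Dec (P zero) → Enumeration (P ∘ suc) → Enumeration P
    extend (no ¬p₀) E = record
      { size = size ; index = idx ; element = suc ∘ element ; element∈ = element∈
      ; index-element = index-element ; index-irrelevant = irr }
      where
        open Enumeration E
        idx : ∀ i → P i → Fin size
        idx zero p = ⊥-elim (¬p₀ p)
        idx (suc i) p = index i p
        irr : ∀ i p p' → idx i p ≡ idx i p'
        irr zero p _ = ⊥-elim (¬p₀ p)
        irr (suc i) = index-irrelevant i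
    extend (yes p₀) E = record
      { size = suc size ; index = idx ; element = elt ; element∈ = elt∈
      ; index-element = idx-elt ; index-irrelevant = irr }
      where
        open Enumeration E
        idx : ∀ i → P i → Fin (suc size)
        idx zero _ = zero
        idx (suc i) p = suc (index i p)
        elt : Fin (suc size) → Fin (suc k)
        elt zero = zero
        elt (suc j) = suc (element j)
        elt∈ : ∀ j → P (elt j)
        elt∈ zero = p₀
        elt∈ (suc j) = element∈ j
        idx-elt : ∀ j p → idx (elt j) p ≡ j
        idx-elt zero _ = refl
        idx-elt (suc j) p = cong suc (index-element j p)
        irr : ∀ i p p' → idx i p ≡ idx i p'
        irr zero _ _ = refl
        irr (suc i) p p' = cong suc (index-irrelevant i p p')

cover-bound : ∀ {k} (P Q : Fin k → Set) (P? : ∀ i → Dec (P i)) (Q? : ∀ i → Dec (Q i)) →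
              (∀ i → P i ⊎ Q i) →
              k ≤ Enumeration.size (enumerate P P?) + Enumeration.size (enumerate Q Q?)
cover-bound {zero} _ _ _ _ _ = z≤n
cover-bound {suc k} P Q P? Q? cover
  with P? zero | Q? zero | cover-bound (P ∘ suc) (Q ∘ suc) (P? ∘ suc) (Q? ∘ suc) (cover ∘ suc)
... | yes _ | yes _ | ih = s≤s (≤-trans ih (+-monoʳ-≤ _ (n≤1+n _)))
... | yes _ | no _  | ih = s≤s ih
... | no _  | yes _ | ih = subst (suc k ≤_) (sym (+-suc _ _)) (s≤s ih)
... | no ¬p | no ¬q | _  = ⊥-elim ([ ¬p , ¬q ] (cover zero))

¬¬-decidable : ∀ {k} (P : Fin k → Set) → ¬ ¬ (∀ i → Dec (P i))
¬¬-decidable {zero} P κ = κ (λ ())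
¬¬-decidable {suc k} P κ =
  ¬¬-excluded-middle λ P₀? → ¬¬-decidable (P ∘ suc) λ P? →
    κ λ { zero → P₀? ; (suc i) → P? i }

module Trim {G : Graph} {k : ℕ} (Γ : EdgeColoring G k) (used? : ∀ i → Dec (Used Γ i)) where
  open Enumeration (enumerate (Used Γ) used?)

  trimmed : EdgeColoring G size
  trimmed = record
    { col = λ u v e → index (col Γ u v e) (u , v , e , refl)
    ; col-edge = λ u v e e' → index-resp _ _ (col-edge Γ u v e e') }

  trimmed-uses-all : UsesAll trimmed
  trimmed-uses-all j with element∈ j
  ... | u , v , e , e≡j =
    u , v , e , trans (index-resp _ (element∈ j) e≡j) (index-element j (element∈ j))

  untrim : ∀ {i} (p : Used Γ i) {u v} →
           Reach (DeleteColor trimmed (index i p)) u v → Reach (DeleteColor Γ i) u v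
  untrim p here = here
  untrim p (step (e , ≢i) r) = step (e , ≢i ∘ index-resp _ p) (untrim p r)

  avoid-unused : ∀ {i} → ¬ Used Γ i → ∀ {u v} → Reach (Adj G) u v → Reach (DeleteColor Γ i) u v
  avoid-unused unused here = here
  avoid-unused unused (step {u} {w} e r) =
    step (e , λ e≡i → unused (u , w , e , e≡i)) (avoid-unused unused r)

  trimmed-md : Connected G → IsMDColoring Γ → IsMDColoring trimmed
  trimmed-md (_ , reach) md u v u≢v with md u v u≢v
  ... | i , sep with used? i
  ...   | yes p = index i p , sep ∘ untrim p
  ...   | no unused = ⊥-elim (sep (avoid-unused unused (reach u v)))

  trim : Connected G → IsMDColoring Γ → HasMD G size
  trim conn md = trimmed , trimmed-uses-all , trimmed-md conn md

module ProductColoring {G H : Graph} {m n : ℕ} (ΓG : EdgeColoring G m) (ΓH : EdgeColoring H n) where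

  colour : ∀ x y → Adj (G □ H) x y → Fin (m + n)
  colour (u , _) (u' , _) (inj₁ (a , _)) = col ΓG u u' a ↑ˡ n
  colour (_ , v) (_ , v') (inj₂ (b , _)) = m ↑ʳ col ΓH v v' b

  product : EdgeColoring (G □ H) (m + n)
  product = record { col = colour ; col-edge = colour-edge }
    where
      colour-edge : ∀ x y e e' → colour x y e ≡ colour y x e'
      colour-edge (u , _) (u' , _) (inj₁ (a , _)) (inj₁ (a' , _)) = cong (_↑ˡ n) (col-edge ΓG u u' a a')
      colour-edge (_ , v) (_ , v') (inj₂ (b , _)) (inj₂ (b' , _)) = cong (m ↑ʳ_) (col-edge ΓH v v' b b')
      colour-edge _ _ (inj₁ (a , _)) (inj₂ (_ , refl)) = ⊥-elim (irrefl G a)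
      colour-edge _ _ (inj₂ (_ , refl)) (inj₁ (a , _)) = ⊥-elim (irrefl G a)

  -- Colours of G are realised in some row, those of H in some column.
  product-uses-all : V G → V H → UsesAll ΓG → UsesAll ΓH → UsesAll product
  product-uses-all u₀ v₀ usesG usesH j with splitAt m j in split
  ... | inj₁ i with usesG i
  ...   | u , u' , a , a≡i =
    (u , v₀) , (u' , v₀) , inj₁ (a , refl) , trans (cong (_↑ˡ n) a≡i) (splitAt⁻¹-↑ˡ split)
  product-uses-all u₀ v₀ usesG usesH j | inj₂ i with usesH i
  ...   | v , v' , b , b≡i =
    (u₀ , v) , (u₀ , v') , inj₂ (b , refl) , trans (cong (m ↑ʳ_) b≡i) (splitAt⁻¹-↑ʳ split)

  project-G : ∀ {i x y} → Reach (DeleteColor product (i ↑ˡ n)) x y →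
              Reach (DeleteColor ΓG i) (proj₁ x) (proj₁ y)
  project-G here = here
  project-G {x = _ , _} (step {w = _ , _} (inj₁ (a , _) , ≢i) r) = step (a , ≢i ∘ cong (_↑ˡ n)) (project-G r)
  project-G {x = _ , _} (step {w = _ , _} (inj₂ (_ , refl) , _) r) = project-G r

  project-H : ∀ {i x y} → Reach (DeleteColor product (m ↑ʳ i)) x y →
              Reach (DeleteColor ΓH i) (proj₂ x) (proj₂ y)
  project-H here = here
  project-H {x = _ , _} (step {w = _ , _} (inj₂ (b , _) , ≢i) r) = step (b , ≢i ∘ cong (m ↑ʳ_)) (project-H r)
  project-H {x = _ , _} (step {w = _ , _} (inj₁ (_ , refl) , _) r) = project-H r

  -- Distinct vertices differ in one coordinate; separate them there.
  product-md : DecidableEquality (V G) → IsMDColoring ΓG → IsMDColoring ΓH → IsMDColoring product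
  product-md _≟G_ mdG mdH (u , v) (u' , v') x≢y with u ≟G u'
  ... | no u≢u' = let (i , sep) = mdG u u' u≢u' in i ↑ˡ n , sep ∘ project-G
  ... | yes refl = let (i , sep) = mdH v v' (x≢y ∘ cong (u ,_)) in m ↑ʳ i , sep ∘ project-H

lower-bound : ∀ {G H m n} → DecidableEquality (V G) → V G → V H →
              HasMD G m → HasMD H n → HasMD (G □ H) (m + n)
lower-bound decG u₀ v₀ (ΓG , usesG , mdG) (ΓH , usesH , mdH) =
  product , product-uses-all u₀ v₀ usesG usesH , product-md decG mdG mdH
  where open ProductColoring ΓG ΓH

row : ∀ {G H k} → EdgeColoring (G □ H) k → V H → EdgeColoring G k
row Γ v = record
  { col = λ u u' a → col Γ (u , v) (u' , v) (inj₁ (a , refl))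
  ; col-edge = λ u u' a a' → col-edge Γ _ _ (inj₁ (a , refl)) (inj₁ (a' , refl)) }

-- Walks inside a row are walks of G □ H, so rows inherit MD-colourings.
row-md : ∀ {G H k} (Γ : EdgeColoring (G □ H) k) v → IsMDColoring Γ → IsMDColoring (row Γ v)
row-md Γ v md u u' u≢u' =
  let (i , sep) = md (u , v) (u' , v) (u≢u' ∘ cong proj₁) in i , sep ∘ lift
  where
    lift : ∀ {i u u'} → Reach (DeleteColor (row Γ v) i) u u' → Reach (DeleteColor Γ i) (u , v) (u' , v)
    lift here = here
    lift (step (a , ≢i) r) = step (inj₁ (a , refl) , ≢i) (lift r)

-- Adjacent rows carry the same colouring: (u,v)(u',v)(u',w)(u,w) is a 4-cycle.
adjacent-rows-agree : ∀ {G H k} (Γ : EdgeColoring (G □ H) k) → IsMDColoring Γ →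
                      ∀ {v w} → Adj H v w → ∀ {u u'} (a : Adj G u u') →
                      col (row Γ v) u u' a ≡ col (row Γ w) u u' a
adjacent-rows-agree {G} {H} Γ md {v} {w} b {u} {u'} a =
  trans (opposite-edges Γ md (u≢u' ∘ cong proj₁) (u≢u' ∘ sym ∘ cong proj₁)
           (inj₁ (a , refl)) (inj₂ (b , refl)) a⁻¹ (inj₂ (adjSym H b , refl)))
        (sym (col-edge Γ (u , w) (u' , w) (inj₁ (a , refl)) a⁻¹))
  where
    u≢u' = adjacent-distinct G a
    a⁻¹ : Adj (G □ H) (u' , w) (u , w)
    a⁻¹ = inj₁ (adjSym G a , refl)

rows-agree : ∀ {G H k} (Γ : EdgeColoring (G □ H) k) → IsMDColoring Γ →
             ∀ {v w} → Reach (Adj H) v w → ∀ {u u'} (a : Adj G u u') →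
             col (row Γ v) u u' a ≡ col (row Γ w) u u' a
rows-agree Γ md here a = refl
rows-agree Γ md (step b r) a = trans (adjacent-rows-agree Γ md b a) (rows-agree Γ md r a)

swap-adj : ∀ {G H u v u' v'} → Adj (G □ H) (u , v) (u' , v') → Adj (H □ G) (v , u) (v' , u')
swap-adj (inj₁ e) = inj₂ e
swap-adj (inj₂ e) = inj₁ e

transpose : ∀ {G H k} → EdgeColoring (G □ H) k → EdgeColoring (H □ G) k
transpose {G} {H} Γ = record
  { col = λ { (v , u) (v' , u') e → col Γ (u , v) (u' , v') (swap-adj {H} {G} e) }
  ; col-edge = λ { (v , u) (v' , u') e e' →
                     col-edge Γ (u , v) (u' , v') (swap-adj {H} {G} e) (swap-adj {H} {G} e') } }

transpose-md : ∀ {G H k} (Γ : EdgeColoring (G □ H) k) → IsMDColoring Γ → IsMDColoring (transpose Γ)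
transpose-md {G} {H} Γ md (v , u) (v' , u') x≢y =
  let (i , sep) = md (u , v) (u' , v') (x≢y ∘ cong swap×) in i , sep ∘ untranspose
  where
    untranspose : ∀ {i v u v' u'} → Reach (DeleteColor (transpose Γ) i) (v , u) (v' , u') →
                  Reach (DeleteColor Γ i) (u , v) (u' , v')
    untranspose here = here
    untranspose (step {w = _ , _} (e , ≢i) r) = step (swap-adj {H} {G} e , ≢i) (untranspose r)

column : ∀ {G H k} → EdgeColoring (G □ H) k → V G → EdgeColoring H k
column Γ = row (transpose Γ)

used-in-layers : ∀ {G H k} (cG : Connected G) (cH : Connected H) (Γ : EdgeColoring (G □ H) k) →
                 IsMDColoring Γ → ∀ i → Used Γ i →
                 Used (row Γ (proj₁ cH)) i ⊎ Used (column Γ (proj₁ cG)) i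
used-in-layers (u₀ , reachG) (v₀ , reachH) Γ md i ((u , v) , (u' , _) , inj₁ (a , refl) , a≡i) =
  inj₁ (u , u' , a , trans (sym (rows-agree Γ md (reachH v v₀) a)) a≡i)
used-in-layers (u₀ , reachG) (v₀ , reachH) Γ md i ((u , v) , (_ , v') , inj₂ (b , refl) , b≡i) =
  inj₂ (v , v' , b , trans (sym (rows-agree (transpose Γ) (transpose-md Γ md) (reachG u u₀) b)) b≡i)

upper-bound : ∀ {G H m n} → Connected G → Connected H →
              (∀ k → HasMD G k → k ≤ m) → (∀ k → HasMD H k → k ≤ n) →
              ∀ k → HasMD (G □ H) k → k ≤ m + n
upper-bound {m = m} {n} cG cH maxG maxH k (Γ , usesΓ , md) =
  decidable-stable (k ≤? m + n) λ k≰ →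
    ¬¬-decidable (Used R) λ R? → ¬¬-decidable (Used C) λ C? →
      k≰ (≤-trans (cover-bound (Used R) (Used C) R? C? (λ i → used-in-layers cG cH Γ md i (usesΓ i)))
                  (+-mono-≤ (maxG _ (Trim.trim R R? cG (row-md Γ _ md)))
                            (maxH _ (Trim.trim C C? cH (row-md (transpose Γ) _ (transpose-md Γ md))))))
  where
    R = row Γ (proj₁ cH)
    C = column Γ (proj₁ cG)

theorem4p1 : (G H : Graph) → Finite (V G) → Finite (V H) →
    Connected G → Connected H →
    (m n : ℕ) → IsMd G m → IsMd H n → IsMd (G □ H) (m + n)
theorem4p1 G H finG _ cG cH m n (hasG , maxG) (hasH , maxH) =
  lower-bound (finite⇒decidableEq finG) (proj₁ cG) (proj₁ cH) hasG hasH ,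
  upper-bound cG cH maxG maxH
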